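{- Let $\mathbb{M}$ be the set of Motzkin numbers of the second kind, enumerated increasingly as $m_0<m_1<m_2<\cdots$, and for $n\ge1$ let $\mathbb{M}_n$ be the set of elements of $\mathbb{M}$ whose base-3 representation has exactly $n$ digits. Then for every $n\ge 2$, with $k=\lfloor n/2\rfloor$, the maximal element of $\mathbb{M}_n$ is $$\max\mathbb{M}_n = 5\cdot 3^{\,n-2k}\cdot\frac{9^k-1}{8},$$ its base-3 representation is $(12)^k0^{\,n-2k}$ (the block $12$ repeated $k$ times followed by $n-2k$ zeros), and it is the element $m_{M_n-1}$, i.e. its index in the enumeration is $M_n-1$, where $M_n$ denotes the $n$-th Motzkin number.
   Context: A Motzkin number of the second kind is a natural number $m$ whose base-3 representation (written without leading zeros, and as the single digit $0$ when $m=0$) contains equally many digits $1$ and $2$, and in which every prefix contains at least as many digits $1$ as digits $2$. The Motzkin number $M_j$ ($j\ge0$) is the number of strings of length $j$ over $\{0,1,2\}$ having equally many $1$'s and $2$'s and in which every prefix has at least as many $1$'s as $2$'s (so $M_0=1,M_1=1,M_2=2,M_3=4,M_4=9,\dots$). The index of $m_i$ is $i$ (indices start at $0$, with $m_0=0$). -}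

module Defs where

open import Data.Nat using (ℕ; zero; suc; _≤_; _+_)
open import Data.Nat.Properties using (_≟_; _≤?_)
open import Data.Nat.DivMod using (_/_; _%_)
open import Data.List using (List; []; _∷_; length; filter; inits; reverse; map; concatMap; upTo)
open import Data.List.Relation.Unary.All using (All; all?)
open import Data.Product using (_×_)
open import Relation.Nullary using (Dec)
open import Relation.Nullary.Decidable using (_×-dec_)
open import Relation.Unary using (Decidable)
open import Relation.Binary.PropositionalEquality using (_≡_)

ones twos : List ℕ → ℕ
ones xs = length (filter (_≟ 1) xs)
twos xs = length (filter (_≟ 2) xs)

IsMotzkinWord : List ℕ → Set
IsMotzkinWord w = ones w ≡ twos w × All (λ p → twos p ≤ ones p) (inits w)

motzkinWord? : Decidable IsMotzkinWord
motzkinWord? w = (ones w ≟ twos w) ×-dec all? (λ p → twos p ≤? ones p) (inits w)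

-- base-3 digits, least significant first; first argument is fuel
base3Rev : ℕ → ℕ → List ℕ
base3Rev zero    _       = []
base3Rev (suc f) zero    = []
base3Rev (suc f) (suc m) = (suc m % 3) ∷ base3Rev f (suc m / 3)

-- base-3 representation, most significant digit first, no leading zeros;
-- 0 is represented by the single digit 0
base3 : ℕ → List ℕ
base3 zero    = 0 ∷ []
base3 (suc m) = reverse (base3Rev (suc m) (suc m))

IsMotzkin2 : ℕ → Set
IsMotzkin2 m = IsMotzkinWord (base3 m)

isMotzkin2? : Decidable IsMotzkin2
isMotzkin2? m = motzkinWord? (base3 m)

-- index of m in the increasing enumeration m_0 < m_1 < ... of Motzkin
-- numbers of the second kind: the number of such numbers below m
index : ℕ → ℕ
index m = length (filter isMotzkin2? (upTo m))

words : ℕ → List (List ℕ)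
words zero    = [] ∷ []
words (suc j) = concatMap (λ d → map (d ∷_) (words j)) (0 ∷ 1 ∷ 2 ∷ [])

motzkin : ℕ → ℕ
motzkin j = length (filter motzkinWord? (words j))

-- The list `words n` is in lexicographic order, so the base-3 values of its
-- entries are 0, 1, …, 3^n − 1 in increasing order, and leading zeros do not
-- affect the Motzkin property. The word (12)^k 0^(n−2k) is Motzkin, and every
-- later word first exceeds it by a 2 in place of a 1 or by a nonzero last
-- digit, so is not. Hence its value is the largest Motzkin number with n
-- digits, and the Motzkin numbers below it are the values of the Motzkin
-- words before it, of which there are M_n − 1.
module Submission where

open import Data.Nat using (ℕ; zero; suc; _≤_; _<_; _*_; _+_; _∸_; _^_; z≤n; s≤s; s≤s⁻¹)
open import Data.Nat.Properties using (suc-injective; +-identityʳ; *-identityˡ; *-identityʳ; +-assoc; +-comm; *-comm; ≤-refl; ≤-trans; ≤-reflexive; <⇒≤; +-mono-≤; +-monoʳ-≤; +-monoˡ-<; *-monoʳ-≤; m≤m+n; m≤n+m; m+n∸n≡m; module ≤-Reasoning)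
open import Data.Nat.DivMod using (_/_; _%_; m≡m%n+[m/n]*n; m%n≡m∸m/n*n; m%n<n; m/n<m; m/n≡1+[m∸n]/n; [m+kn]%n≡m%n; m<n⇒m%n≡m; m*n%n≡0; m<n⇒m/n≡0; m*n/n≡m; +-distrib-/)
open import Data.Nat.Tactic.RingSolver using (solve-∀)
open import Data.List using (List; []; _∷_; _++_; _∷ʳ_; length; concat; replicate; map; filter; reverse; upTo; applyUpTo)
open import Data.List.Properties using (map-++; map-∘; map-cong-local; ++-assoc; ∷-injective; unfold-reverse; reverse-involutive; length-reverse; length-++; filter-++; filter-accept; filter-none)
open import Data.List.Relation.Unary.All as All using (All; []; _∷_)
import Data.List.Relation.Unary.All.Properties as All
import Data.List.Relation.Unary.Any.Properties as Any
open import Data.List.Relation.Unary.Any using (here; there)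
open import Data.List.Membership.Propositional using (_∈_)
open import Data.List.Membership.Propositional.Properties using (∈-map⁻; ∈-map⁺; ∈-++⁻; ∈-upTo⁺; ∈-upTo⁻)
open import Data.Product using (_×_; _,_; proj₁)
open import Data.Sum using (inj₁; inj₂)
open import Data.Empty using (⊥-elim)
open import Function using (_∘_; id; _⇔_; mk⇔; Equivalence)
import Function.Properties.Equivalence as ⇔
open import Relation.Nullary using (¬_; yes; no)
open import Relation.Unary using (Decidable)
open import Relation.Binary.PropositionalEquality
open import Defs

module _ {w : List ℕ} where

  motzkin-0∷ : IsMotzkinWord (0 ∷ w) ⇔ IsMotzkinWord w
  motzkin-0∷ = mk⇔ (λ { (e , _ ∷ ps) → e , All.map⁻ ps })
                   (λ { (e , ps) → e , z≤n ∷ All.map⁺ ps })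

  motzkin-12∷ : IsMotzkinWord (1 ∷ 2 ∷ w) ⇔ IsMotzkinWord w
  motzkin-12∷ = mk⇔ from12 (λ { (e , ps) → cong suc e , z≤n ∷ All.map⁺ (z≤n ∷ All.map⁺ (All.map s≤s ps)) })
    where
    from12 : IsMotzkinWord (1 ∷ 2 ∷ w) → IsMotzkinWord w
    from12 (e , _ ∷ ps) with All.map⁻ ps
    ... | _ ∷ qs = suc-injective e , All.map s≤s⁻¹ (All.map⁻ qs)

  ¬motzkin-2∷ : ¬ IsMotzkinWord (2 ∷ w)
  ¬motzkin-2∷ (_ , _ ∷ () ∷ _)

¬motzkin-1 : ¬ IsMotzkinWord (1 ∷ [])
¬motzkin-1 (() , _)

maxMotzkinWord : ℕ → List ℕ
maxMotzkinWord zero          = []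
maxMotzkinWord (suc zero)    = 0 ∷ []
maxMotzkinWord (suc (suc n)) = 1 ∷ 2 ∷ maxMotzkinWord n

maxMotzkinWord-isMotzkin : ∀ n → IsMotzkinWord (maxMotzkinWord n)
maxMotzkinWord-isMotzkin zero          = refl , z≤n ∷ []
maxMotzkinWord-isMotzkin (suc zero)    = Equivalence.from motzkin-0∷ (maxMotzkinWord-isMotzkin zero)
maxMotzkinWord-isMotzkin (suc (suc n)) = Equivalence.from motzkin-12∷ (maxMotzkinWord-isMotzkin n)

record Split {A : Set} (P : A → Set) (xs : List A) (x : A) : Set where
  field
    before after : List A
    xs≡        : xs ≡ before ++ x ∷ after
    all-after  : All P after

module _ {A : Set} {P : A → Set} {x : A} where

  split-++ˡ : ∀ xs {ys} → Split P ys x → Split P (xs ++ ys) x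
  split-++ˡ xs {ys} s = record
    { before = xs ++ before ; after = after ; all-after = all-after
    ; xs≡ = trans (cong (xs ++_) xs≡) (sym (++-assoc xs before (x ∷ after))) }
    where open Split s

  split-++ʳ : ∀ {ys zs} → Split P ys x → All P zs → Split P (ys ++ zs) x
  split-++ʳ {zs = zs} s pzs = record
    { before = before ; after = after ++ zs ; all-after = All.++⁺ all-after pzs
    ; xs≡ = trans (cong (_++ zs) xs≡) (++-assoc before (x ∷ after) zs) }
    where open Split s

  split-map : ∀ {B : Set} {Q : B → Set} (f : A → B) → (∀ {y} → P y → Q (f y)) →
              ∀ {xs} → Split P xs x → Split Q (map f xs) (f x)
  split-map f P⇒Q s = record
    { before = map f before ; after = map f after ; all-after = All.map⁺ (All.map P⇒Q all-after)
    ; xs≡ = trans (cong (map f) xs≡) (map-++ f before (x ∷ after)) }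
    where open Split s

words-split : ∀ n → Split (¬_ ∘ IsMotzkinWord) (words n) (maxMotzkinWord n)
words-split zero          = record { before = [] ; after = [] ; xs≡ = refl ; all-after = [] }
words-split (suc zero)    = record
  { before = [] ; after = (1 ∷ []) ∷ (2 ∷ []) ∷ [] ; xs≡ = refl ; all-after = ¬motzkin-1 ∷ ¬motzkin-2∷ ∷ [] }
words-split (suc (suc n)) =
  split-++ˡ (map (0 ∷_) W′) (split-++ʳ (split-map (1 ∷_) id inner) (All.++⁺ (All.map⁺ (All.universal (λ _ → ¬motzkin-2∷) W′)) []))
  where
  W W′ : List (List ℕ)
  W  = words n
  W′ = words (suc n)
  inner : Split (λ u → ¬ IsMotzkinWord (1 ∷ u)) W′ (2 ∷ maxMotzkinWord n)
  inner = split-++ˡ (map (0 ∷_) W) (split-++ˡ (map (1 ∷_) W)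
            (split-++ʳ (split-map (2 ∷_) (λ ¬m → ¬m ∘ Equivalence.to motzkin-12∷) (words-split n)) []))

Digits : List ℕ → Set
Digits = All (_< 3)

fromBase3 : List ℕ → ℕ
fromBase3 []      = 0
fromBase3 (d ∷ w) = d * 3 ^ length w + fromBase3 w

words-length : ∀ j → All (λ w → length w ≡ j) (words j)
words-length zero    = refl ∷ []
words-length (suc j) = All.++⁺ (prepend 0) (All.++⁺ (prepend 1) (All.++⁺ (prepend 2) []))
  where
  prepend : ∀ d → All (λ w → length w ≡ suc j) (map (d ∷_) (words j))
  prepend d = All.map⁺ (All.map (cong suc) (words-length j))

words-digits : ∀ j → All Digits (words j)
words-digits zero    = [] ∷ []
words-digits (suc j) = All.++⁺ (prepend 0 (s≤s z≤n)) (All.++⁺ (prepend 1 (s≤s (s≤s z≤n))) (All.++⁺ (prepend 2 ≤-refl) []))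
  where
  prepend : ∀ d → d < 3 → All Digits (map (d ∷_) (words j))
  prepend d d<3 = All.map⁺ (All.map (d<3 ∷_) (words-digits j))

applyUpTo-+ : ∀ {A : Set} (f : ℕ → A) m n → applyUpTo f (m + n) ≡ applyUpTo f m ++ applyUpTo (f ∘ (m +_)) n
applyUpTo-+ f zero    n = refl
applyUpTo-+ f (suc m) n = cong (f 0 ∷_) (applyUpTo-+ (f ∘ suc) m n)

-- Generalised over f so that the inductive step can absorb the offset d * 3^j of the block d ∷ _.
fromBase3-words : ∀ j (f : ℕ → ℕ) → map (f ∘ fromBase3) (words j) ≡ applyUpTo f (3 ^ j)
fromBase3-words zero    f = refl
fromBase3-words (suc j) f = begin
    map g (map (0 ∷_) W ++ (map (1 ∷_) W ++ (map (2 ∷_) W ++ [])))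
  ≡⟨ map-++ g (map (0 ∷_) W) _ ⟩
    map g (map (0 ∷_) W) ++ map g (map (1 ∷_) W ++ (map (2 ∷_) W ++ []))
  ≡⟨ cong (map g (map (0 ∷_) W) ++_) (map-++ g (map (1 ∷_) W) _) ⟩
    map g (map (0 ∷_) W) ++ (map g (map (1 ∷_) W) ++ map g (map (2 ∷_) W ++ []))
  ≡⟨ cong (λ z → map g (map (0 ∷_) W) ++ (map g (map (1 ∷_) W) ++ z)) (map-++ g (map (2 ∷_) W) []) ⟩
    map g (map (0 ∷_) W) ++ (map g (map (1 ∷_) W) ++ (map g (map (2 ∷_) W) ++ []))
  ≡⟨ cong₂ (λ a b → a ++ (b ++ (map g (map (2 ∷_) W) ++ [])))
       (block 0 f (λ _ → refl)) (block 1 (f ∘ (N +_)) (λ x → cong (λ y → f (y + x)) (*-identityˡ N))) ⟩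
    applyUpTo f N ++ (applyUpTo (f ∘ (N +_)) N ++ (map g (map (2 ∷_) W) ++ []))
  ≡⟨ cong (λ c → applyUpTo f N ++ (applyUpTo (f ∘ (N +_)) N ++ (c ++ [])))
       (block 2 (f ∘ (N +_) ∘ (N +_)) (λ x → cong f (trans (cong (λ y → N + y + x) (+-identityʳ N)) (+-assoc N N x)))) ⟩
    applyUpTo f N ++ (applyUpTo (f ∘ (N +_)) N ++ (applyUpTo (f ∘ (N +_) ∘ (N +_)) N ++ []))
  ≡⟨ cong (λ z → applyUpTo f N ++ (applyUpTo (f ∘ (N +_)) N ++ z)) (applyUpTo-+ (f ∘ (N +_) ∘ (N +_)) N 0) ⟨
    applyUpTo f N ++ (applyUpTo (f ∘ (N +_)) N ++ applyUpTo (f ∘ (N +_) ∘ (N +_)) (N + 0))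
  ≡⟨ cong (applyUpTo f N ++_) (applyUpTo-+ (f ∘ (N +_)) N (N + 0)) ⟨
    applyUpTo f N ++ applyUpTo (f ∘ (N +_)) (N + (N + 0))
  ≡⟨ applyUpTo-+ f N (N + (N + 0)) ⟨
    applyUpTo f (3 ^ suc j)
  ∎
  where
  open ≡-Reasoning
  W = words j
  N = 3 ^ j
  g = f ∘ fromBase3
  block : ∀ d (h : ℕ → ℕ) → (∀ x → f (d * N + x) ≡ h x) → map g (map (d ∷_) W) ≡ applyUpTo h N
  block d h f≡h = begin
      map g (map (d ∷_) W)
    ≡⟨ map-∘ W ⟨
      map (g ∘ (d ∷_)) W
    ≡⟨ map-cong-local (All.map (λ {w} |w|≡j → trans (cong (λ l → f (d * 3 ^ l + fromBase3 w)) |w|≡j) (f≡h (fromBase3 w)))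
                                (words-length j)) ⟩
      map (h ∘ fromBase3) W
    ≡⟨ fromBase3-words j h ⟩
      applyUpTo h N
    ∎

applyUpTo-prefix : ∀ {A : Set} (f : ℕ → A) N xs y ys → xs ++ y ∷ ys ≡ applyUpTo f N →
                   xs ≡ applyUpTo f (length xs) × y ≡ f (length xs)
applyUpTo-prefix f (suc N) []       y ys eq = refl , proj₁ (∷-injective eq)
applyUpTo-prefix f (suc N) (x ∷ xs) y ys eq with ∷-injective eq
... | x≡ , rest with applyUpTo-prefix (f ∘ suc) N xs y ys rest
...   | xs≡ , y≡ = cong₂ _∷_ x≡ xs≡ , y≡

fromBase3Rev : List ℕ → ℕ
fromBase3Rev []       = 0
fromBase3Rev (d ∷ ds) = d + 3 * fromBase3Rev ds

fromBase3Rev-∷ʳ : ∀ ds d → fromBase3Rev (ds ∷ʳ d) ≡ fromBase3Rev ds + d * 3 ^ length ds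
fromBase3Rev-∷ʳ []       d = trans (+-identityʳ d) (sym (*-identityʳ d))
fromBase3Rev-∷ʳ (e ∷ ds) d = trans (cong (λ v → e + 3 * v) (fromBase3Rev-∷ʳ ds d))
                                   (shift e (fromBase3Rev ds) d (3 ^ length ds))
  where
  shift : ∀ e v d p → e + 3 * (v + d * p) ≡ e + 3 * v + d * (3 * p)
  shift = solve-∀

fromBase3≡fromBase3Rev∘reverse : ∀ w → fromBase3 w ≡ fromBase3Rev (reverse w)
fromBase3≡fromBase3Rev∘reverse []      = refl
fromBase3≡fromBase3Rev∘reverse (d ∷ w) = begin
    d * 3 ^ length w + fromBase3 w
  ≡⟨ cong₂ (λ l v → d * 3 ^ l + v) (sym (length-reverse w)) (fromBase3≡fromBase3Rev∘reverse w) ⟩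
    d * 3 ^ length (reverse w) + fromBase3Rev (reverse w)
  ≡⟨ +-comm _ (fromBase3Rev (reverse w)) ⟩
    fromBase3Rev (reverse w) + d * 3 ^ length (reverse w)
  ≡⟨ fromBase3Rev-∷ʳ (reverse w) d ⟨
    fromBase3Rev (reverse w ∷ʳ d)
  ≡⟨ cong fromBase3Rev (unfold-reverse d w) ⟨
    fromBase3Rev (reverse (d ∷ w))
  ∎
  where open ≡-Reasoning

base3Rev-0 : ∀ f → base3Rev f 0 ≡ []
base3Rev-0 zero    = refl
base3Rev-0 (suc f) = refl

base3Rev-digit : ∀ f x v → x < 3 → 0 < x + 3 * v → base3Rev (suc f) (x + 3 * v) ≡ x ∷ base3Rev f v
base3Rev-digit f x v x<3 pos = begin
    base3Rev (suc f) (x + 3 * v)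
  ≡⟨ unfold (x + 3 * v) pos ⟩
    (x + 3 * v) % 3 ∷ base3Rev f ((x + 3 * v) / 3)
  ≡⟨ cong (λ m → m % 3 ∷ base3Rev f (m / 3)) (cong (x +_) (*-comm 3 v)) ⟩
    (x + v * 3) % 3 ∷ base3Rev f ((x + v * 3) / 3)
  ≡⟨ cong₂ (λ d q → d ∷ base3Rev f q) (trans ([m+kn]%n≡m%n x v 3) x%3≡x) quotient ⟩
    x ∷ base3Rev f v
  ∎
  where
  open ≡-Reasoning
  unfold : ∀ m → 0 < m → base3Rev (suc f) m ≡ m % 3 ∷ base3Rev f (m / 3)
  unfold (suc m) _ = refl
  x%3≡x : x % 3 ≡ x
  x%3≡x = m<n⇒m%n≡m x<3
  quotient : (x + v * 3) / 3 ≡ v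
  quotient = begin
      (x + v * 3) / 3
    ≡⟨ +-distrib-/ x (v * 3) (subst (_< 3) (sym (trans (cong₂ _+_ x%3≡x (m*n%n≡0 v 3)) (+-identityʳ x))) x<3) ⟩
      x / 3 + v * 3 / 3
    ≡⟨ cong₂ _+_ (m<n⇒m/n≡0 x<3) (m*n/n≡m v 3) ⟩
      v
    ∎

-- base3 m runs base3Rev with fuel m; this bound shows that the fuel suffices.
length<fromBase3Rev : ∀ xs d → length xs < fromBase3Rev (xs ∷ʳ suc d)
length<fromBase3Rev []       d = s≤s z≤n
length<fromBase3Rev (x ∷ xs) d = begin-strict
    suc (length xs)
  <⟨ +-mono-≤ (≤-trans (s≤s z≤n) ih) ih ⟩
    v + v
  ≤⟨ +-monoʳ-≤ v (m≤m+n v (v + 0)) ⟩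
    3 * v
  ≤⟨ m≤n+m (3 * v) x ⟩
    x + 3 * v
  ∎
  where
  open ≤-Reasoning
  v = fromBase3Rev (xs ∷ʳ suc d)
  ih = length<fromBase3Rev xs d

base3Rev-fromBase3Rev : ∀ f xs d → Digits (xs ∷ʳ suc d) → length xs < f →
                        base3Rev f (fromBase3Rev (xs ∷ʳ suc d)) ≡ xs ∷ʳ suc d
base3Rev-fromBase3Rev (suc f) []       d (d<3 ∷ []) _ =
  trans (base3Rev-digit f (suc d) 0 d<3 (s≤s z≤n)) (cong (suc d ∷_) (base3Rev-0 f))
base3Rev-fromBase3Rev (suc f) (x ∷ xs) d (x<3 ∷ ds) (s≤s fuel) = begin
    base3Rev (suc f) (x + 3 * v)
  ≡⟨ base3Rev-digit f x v x<3 0<x+3v ⟩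
    x ∷ base3Rev f v
  ≡⟨ cong (x ∷_) (base3Rev-fromBase3Rev f xs d ds fuel) ⟩
    x ∷ xs ∷ʳ suc d
  ∎
  where
  open ≡-Reasoning
  v = fromBase3Rev (xs ∷ʳ suc d)
  0<x+3v : 0 < x + 3 * v
  0<x+3v = ≤-trans (≤-trans (s≤s z≤n) (length<fromBase3Rev xs d)) (≤-trans (m≤m+n v (v + (v + 0))) (m≤n+m (3 * v) x))

base3-fromBase3 : ∀ d w → Digits (suc d ∷ w) → base3 (fromBase3 (suc d ∷ w)) ≡ suc d ∷ w
base3-fromBase3 d w (d<3 ∷ ws) = begin
    base3 (fromBase3 (suc d ∷ w))
  ≡⟨ cong base3 (trans (fromBase3≡fromBase3Rev∘reverse (suc d ∷ w)) (cong fromBase3Rev (unfold-reverse (suc d) w))) ⟩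
    base3 v
  ≡⟨ unfold v (≤-trans (s≤s z≤n) (length<fromBase3Rev (reverse w) d)) ⟩
    reverse (base3Rev v v)
  ≡⟨ cong reverse (base3Rev-fromBase3Rev v (reverse w) d (All.∷ʳ⁺ reverse-digits d<3) (length<fromBase3Rev (reverse w) d)) ⟩
    reverse (reverse w ∷ʳ suc d)
  ≡⟨ cong reverse (unfold-reverse (suc d) w) ⟨
    reverse (reverse (suc d ∷ w))
  ≡⟨ reverse-involutive (suc d ∷ w) ⟩
    suc d ∷ w
  ∎
  where
  open ≡-Reasoning
  v = fromBase3Rev (reverse w ∷ʳ suc d)
  unfold : ∀ m → 0 < m → base3 m ≡ reverse (base3Rev m m)
  unfold (suc m) _ = refl
  reverse-digits : Digits (reverse w)
  reverse-digits = All.tabulate (All.lookup ws ∘ Any.reverse⁻)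

base3-length-bound : ∀ m → m < 3 ^ length (base3 m)
base3-length-bound zero    = s≤s z≤n
base3-length-bound (suc m) = subst (λ l → suc m < 3 ^ l) (sym (length-reverse (base3Rev (suc m) (suc m))))
                             (base3Rev-length (suc m) (suc m) ≤-refl)
  where
  base3Rev-length : ∀ f m → m ≤ f → m < 3 ^ length (base3Rev f m)
  base3Rev-length zero    zero    _         = s≤s z≤n
  base3Rev-length (suc f) zero    _         = s≤s z≤n
  base3Rev-length (suc f) (suc m) (s≤s m≤f) = begin-strict
      suc m
    ≡⟨ m≡m%n+[m/n]*n (suc m) 3 ⟩
      suc m % 3 + q * 3
    <⟨ +-monoˡ-< (q * 3) (m%n<n (suc m) 3) ⟩
      3 + q * 3
    ≡⟨ *-comm (suc q) 3 ⟩
      3 * suc q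
    ≤⟨ *-monoʳ-≤ 3 (base3Rev-length f q (≤-trans (s≤s⁻¹ (m/n<m (suc m) 3 (s≤s (s≤s z≤n)))) m≤f)) ⟩
      3 * 3 ^ length (base3Rev f q)
    ∎
    where
    open ≤-Reasoning
    q = suc m / 3

isMotzkin2-fromBase3 : ∀ w → Digits w → IsMotzkin2 (fromBase3 w) ⇔ IsMotzkinWord w
isMotzkin2-fromBase3 []          _          = motzkin-0∷
isMotzkin2-fromBase3 (zero ∷ w)  (_ ∷ ws)   = ⇔.trans (isMotzkin2-fromBase3 w ws) (⇔.sym motzkin-0∷)
isMotzkin2-fromBase3 (suc d ∷ w) ws rewrite base3-fromBase3 d w ws = ⇔.refl

length-filter-map : ∀ {A B : Set} {P : B → Set} {Q : A → Set} (P? : Decidable P) (Q? : Decidable Q) (f : A → B) →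
                    ∀ {xs} → All (λ x → P (f x) ⇔ Q x) xs → length (filter P? (map f xs)) ≡ length (filter Q? xs)
length-filter-map P? Q? f {[]}     []           = refl
length-filter-map P? Q? f {x ∷ xs} (Pfx⇔Qx ∷ ps) with P? (f x) | Q? x
... | yes _   | yes _  = cong suc (length-filter-map P? Q? f ps)
... | yes Pfx | no ¬Qx = ⊥-elim (¬Qx (Equivalence.to Pfx⇔Qx Pfx))
... | no ¬Pfx | yes Qx = ⊥-elim (¬Pfx (Equivalence.from Pfx⇔Qx Qx))
... | no _    | no _   = length-filter-map P? Q? f ps

module _ (n : ℕ) where
  open Split (words-split n)

  private
    values : map fromBase3 before ++ fromBase3 (maxMotzkinWord n) ∷ map fromBase3 after ≡ upTo (3 ^ n)
    values = trans (sym (map-++ fromBase3 before (maxMotzkinWord n ∷ after)))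
                   (trans (cong (map fromBase3) (sym xs≡)) (fromBase3-words n id))

    digits : All Digits (before ++ maxMotzkinWord n ∷ after)
    digits = subst (All Digits) xs≡ (words-digits n)

  fromBase3-before : map fromBase3 before ≡ upTo (fromBase3 (maxMotzkinWord n))
  fromBase3-before with applyUpTo-prefix id (3 ^ n) (map fromBase3 before) _ (map fromBase3 after) values
  ... | before≡ , t≡ = trans before≡ (cong upTo (sym t≡))

  motzkin2-≤-maxMotzkinWord : ∀ w → IsMotzkin2 w → length (base3 w) ≡ n → w ≤ fromBase3 (maxMotzkinWord n)
  motzkin2-≤-maxMotzkinWord w w-motzkin |w|≡n
    with ∈-map⁻ fromBase3 (subst (w ∈_) (sym (trans (map-++ fromBase3 before (maxMotzkinWord n ∷ after)) values))
                            (∈-upTo⁺ (subst (λ l → w < 3 ^ l) |w|≡n (base3-length-bound w))))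
  ... | u , u∈ , refl with ∈-++⁻ before u∈
  ... | inj₁ u∈before       = <⇒≤ (∈-upTo⁻ (subst (fromBase3 u ∈_) fromBase3-before (∈-map⁺ fromBase3 u∈before)))
  ... | inj₂ (here u≡t)     = ≤-reflexive (cong fromBase3 u≡t)
  ... | inj₂ (there u∈after) =
    ⊥-elim (All.lookup all-after u∈after
             (Equivalence.to (isMotzkin2-fromBase3 u (All.lookup (All.++⁻ʳ before digits) (there u∈after))) w-motzkin))

  index-maxMotzkinWord : index (fromBase3 (maxMotzkinWord n)) ≡ motzkin n ∸ 1
  index-maxMotzkinWord = begin
      length (filter isMotzkin2? (upTo (fromBase3 (maxMotzkinWord n))))
    ≡⟨ cong (length ∘ filter isMotzkin2?) fromBase3-before ⟨
      length (filter isMotzkin2? (map fromBase3 before))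
    ≡⟨ length-filter-map isMotzkin2? motzkinWord? fromBase3 (All.map (λ {u} → isMotzkin2-fromBase3 u) (All.++⁻ˡ before digits)) ⟩
      m
    ≡⟨ m+n∸n≡m m 1 ⟨
      m + 1 ∸ 1
    ≡⟨ cong (_∸ 1) motzkin≡ ⟨
      motzkin n ∸ 1
    ∎
    where
    open ≡-Reasoning
    m = length (filter motzkinWord? before)
    motzkin≡ : motzkin n ≡ m + 1
    motzkin≡ = begin
        length (filter motzkinWord? (words n))
      ≡⟨ cong (length ∘ filter motzkinWord?) xs≡ ⟩
        length (filter motzkinWord? (before ++ maxMotzkinWord n ∷ after))
      ≡⟨ cong length (filter-++ motzkinWord? before _) ⟩
        length (filter motzkinWord? before ++ filter motzkinWord? (maxMotzkinWord n ∷ after))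
      ≡⟨ length-++ (filter motzkinWord? before) ⟩
        m + length (filter motzkinWord? (maxMotzkinWord n ∷ after))
      ≡⟨ cong (λ ws → m + length ws) (filter-accept motzkinWord? (maxMotzkinWord-isMotzkin n)) ⟩
        m + suc (length (filter motzkinWord? after))
      ≡⟨ cong (λ ws → m + suc (length ws)) (filter-none motzkinWord? all-after) ⟩
        m + 1
      ∎

geometric9 : ℕ → ℕ
geometric9 zero    = 0
geometric9 (suc k) = geometric9 k + 9 ^ k

9^k≡1+8*geometric9 : ∀ k → 9 ^ k ≡ 1 + 8 * geometric9 k
9^k≡1+8*geometric9 zero    = refl
9^k≡1+8*geometric9 (suc k) rewrite 9^k≡1+8*geometric9 k = step (geometric9 k)
  where
  step : ∀ g → 9 * (1 + 8 * g) ≡ 1 + 8 * (g + (1 + 8 * g))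
  step = solve-∀

[9^k∸1]/8≡geometric9 : ∀ k → (9 ^ k ∸ 1) / 8 ≡ geometric9 k
[9^k∸1]/8≡geometric9 k = begin
    (9 ^ k ∸ 1) / 8
  ≡⟨ cong (λ m → (m ∸ 1) / 8) (9^k≡1+8*geometric9 k) ⟩
    8 * geometric9 k / 8
  ≡⟨ cong (_/ 8) (*-comm 8 (geometric9 k)) ⟩
    geometric9 k * 8 / 8
  ≡⟨ m*n/n≡m (geometric9 k) 8 ⟩
    geometric9 k
  ∎
  where open ≡-Reasoning

[2+n]/2≡1+n/2 : ∀ n → (2 + n) / 2 ≡ 1 + n / 2
[2+n]/2≡1+n/2 n = m/n≡1+[m∸n]/n {2 + n} (s≤s (s≤s z≤n))

3^n≡3^[n%2]*9^[n/2] : ∀ n → 3 ^ n ≡ 3 ^ (n % 2) * 9 ^ (n / 2)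
3^n≡3^[n%2]*9^[n/2] zero          = refl
3^n≡3^[n%2]*9^[n/2] (suc zero)    = refl
3^n≡3^[n%2]*9^[n/2] (suc (suc n)) rewrite [2+n]/2≡1+n/2 n | 3^n≡3^[n%2]*9^[n/2] n = step (3 ^ (n % 2)) (9 ^ (n / 2))
  where
  step : ∀ a b → 3 * (3 * (a * b)) ≡ a * (9 * b)
  step = solve-∀

length-maxMotzkinWord : ∀ n → length (maxMotzkinWord n) ≡ n
length-maxMotzkinWord zero          = refl
length-maxMotzkinWord (suc zero)    = refl
length-maxMotzkinWord (suc (suc n)) = cong (suc ∘ suc) (length-maxMotzkinWord n)

maxMotzkinWord-digits : ∀ n → Digits (maxMotzkinWord n)
maxMotzkinWord-digits zero          = []
maxMotzkinWord-digits (suc zero)    = s≤s z≤n ∷ []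
maxMotzkinWord-digits (suc (suc n)) = s≤s (s≤s z≤n) ∷ ≤-refl ∷ maxMotzkinWord-digits n

maxMotzkinWord≡blocks : ∀ n → maxMotzkinWord n ≡ concat (replicate (n / 2) (1 ∷ 2 ∷ [])) ++ replicate (n % 2) 0
maxMotzkinWord≡blocks zero          = refl
maxMotzkinWord≡blocks (suc zero)    = refl
maxMotzkinWord≡blocks (suc (suc n)) rewrite [2+n]/2≡1+n/2 n = cong (λ w → 1 ∷ 2 ∷ w) (maxMotzkinWord≡blocks n)

fromBase3-maxMotzkinWord : ∀ n → fromBase3 (maxMotzkinWord n) ≡ 5 * 3 ^ (n % 2) * geometric9 (n / 2)
fromBase3-maxMotzkinWord zero          = refl
fromBase3-maxMotzkinWord (suc zero)    = refl
fromBase3-maxMotzkinWord (suc (suc n))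
  rewrite length-maxMotzkinWord n | fromBase3-maxMotzkinWord n | 3^n≡3^[n%2]*9^[n/2] n | [2+n]/2≡1+n/2 n
  = step (3 ^ (n % 2)) (9 ^ (n / 2)) (geometric9 (n / 2))
  where
  step : ∀ a b g → 1 * (3 * (a * b)) + (2 * (a * b) + 5 * a * g) ≡ 5 * a * (g + b)
  step = solve-∀

n%2≡n∸2*[n/2] : ∀ n → n % 2 ≡ n ∸ 2 * (n / 2)
n%2≡n∸2*[n/2] n = trans (m%n≡m∸m/n*n n 2) (cong (n ∸_) (*-comm (n / 2) 2))

base3-maxMotzkinWord : ∀ n → 2 ≤ n → base3 (fromBase3 (maxMotzkinWord n)) ≡ maxMotzkinWord n
base3-maxMotzkinWord (suc zero)    (s≤s ())
base3-maxMotzkinWord (suc (suc n)) _ = base3-fromBase3 0 (2 ∷ maxMotzkinWord n) (maxMotzkinWord-digits (suc (suc n)))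

mainTheorem3 : (n : ℕ) → 2 ≤ n →
    let k = n / 2
        v = 5 * 3 ^ (n ∸ 2 * k) * ((9 ^ k ∸ 1) / 8)
    in (IsMotzkin2 v × length (base3 v) ≡ n
         × ((w : ℕ) → IsMotzkin2 w → length (base3 w) ≡ n → w ≤ v))
       × base3 v ≡ concat (replicate k (1 ∷ 2 ∷ [])) ++ replicate (n ∸ 2 * k) 0
       × index v ≡ motzkin n ∸ 1
mainTheorem3 n 2≤n = subst₂ Facts value≡ word≡
  ( ( subst IsMotzkinWord (sym base3≡) (maxMotzkinWord-isMotzkin n)
    , trans (cong length base3≡) (length-maxMotzkinWord n)
    , motzkin2-≤-maxMotzkinWord n )
  , base3≡
  , index-maxMotzkinWord n )
  where
  Facts : ℕ → List ℕ → Set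
  Facts v t = (IsMotzkin2 v × length (base3 v) ≡ n × ((w : ℕ) → IsMotzkin2 w → length (base3 w) ≡ n → w ≤ v))
              × base3 v ≡ t × index v ≡ motzkin n ∸ 1
  base3≡ : base3 (fromBase3 (maxMotzkinWord n)) ≡ maxMotzkinWord n
  base3≡ = base3-maxMotzkinWord n 2≤n
  value≡ : fromBase3 (maxMotzkinWord n) ≡ 5 * 3 ^ (n ∸ 2 * (n / 2)) * ((9 ^ (n / 2) ∸ 1) / 8)
  value≡ = trans (fromBase3-maxMotzkinWord n)
                 (cong₂ (λ r g → 5 * 3 ^ r * g) (n%2≡n∸2*[n/2] n) (sym ([9^k∸1]/8≡geometric9 (n / 2))))
  word≡ : maxMotzkinWord n ≡ concat (replicate (n / 2) (1 ∷ 2 ∷ [])) ++ replicate (n ∸ 2 * (n / 2)) 0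
  word≡ = trans (maxMotzkinWord≡blocks n) (cong (λ r → concat (replicate (n / 2) (1 ∷ 2 ∷ [])) ++ replicate r 0) (n%2≡n∸2*[n/2] n))
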